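{- For integers $n>k\ge1$, $F(n,k,k-1)=\max\{k+1,\,n-k+1\}$.
   Context: $F(n,k,l)$ is the maximum size of a family $\mathcal V$ of vectors in $\{0,\pm1\}^n$, each with exactly $k$ nonzero coordinates, such that $\langle\mathbf v,\mathbf w\rangle\ge l$ for all $\mathbf v,\mathbf w\in\mathcal V$ (standard scalar product). -}

module Defs where

open import Data.Nat using (ℕ)
open import Data.Integer using (ℤ; _+_; _*_; _≤_; +_; -[1+_])
open import Data.Vec using (Vec; foldr; zipWith; map)
open import Data.List using (List; length)
open import Data.List.Relation.Unary.All using (All)
open import Data.List.Relation.Unary.Unique.Propositional using (Unique)
open import Data.Product using (_×_)

data Sgn : Set where
  neg zer pos : Sgn

toℤ : Sgn → ℤ
toℤ neg = -[1+ 0 ]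
toℤ zer = + 0
toℤ pos = + 1

SVec : ℕ → Set
SVec n = Vec Sgn n

nz : Sgn → ℕ
nz zer = 0
nz _   = 1

weight : ∀ {n} → SVec n → ℕ
weight v = foldr _ Data.Nat._+_ 0 (map nz v)

inner : ∀ {n} → SVec n → SVec n → ℤ
inner v w = foldr _ _+_ (+ 0) (zipWith (λ a b → toℤ a * toℤ b) v w)

-- 𝒱 (a finite family, given as a duplicate-free list) is admissible for (n,k,l):
-- every vector has exactly k nonzero coordinates and all pairwise scalar
-- products (including v = w) are ≥ l.
Admissible : (n k : ℕ) (l : ℤ) → List (SVec n) → Set
Admissible n k l 𝒱 =
  Unique 𝒱 ×
  All (λ v → weight v ≡ k) 𝒱 ×
  All (λ v → All (λ w → l ≤ inner v w) 𝒱) 𝒱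
  where open import Relation.Binary.PropositionalEquality using (_≡_)

IsF : (n k : ℕ) (l : ℤ) (m : ℕ) → Set
IsF n k l m =
  Σ (List (SVec n)) (λ 𝒱 → Admissible n k l 𝒱 × length 𝒱 ≡ m) ×
  (∀ (𝒱 : List (SVec n)) → Admissible n k l 𝒱 → length 𝒱 Data.Nat.≤ m)
  where
  open import Data.Product using (Σ)
  open import Relation.Binary.PropositionalEquality using (_≡_)

-- Passing to supports reduces the problem to set systems. Two distinct vectors with the same
-- support have inner product at most k - 2, so an admissible family for l = k - 1 has distinct
-- supports, which are k-sets pairwise meeting in at least k - 1 points; conversely the indicator
-- vectors of such a set system are admissible. For two members p ≠ q, the core p ∩ q has k - 1
-- points and the hull p ∪ q has k + 1, and the identity
--   |r ∩ p| + |r ∩ q| = |r ∩ (p ∪ q)| + |r ∩ p ∩ q|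
-- shows that every member r contains the core or lies in the hull. A member containing the core
-- but not in the hull would meet a member in the hull but not containing the core in fewer than
-- k - 1 points, so either all members contain the core (at most n - k + 1 of them) or all are
-- k-subsets of the hull (at most k + 1). The upper covers of a (k-1)-set and the lower covers
-- of a (k+1)-set attain these bounds.

module Submission where

open import Defs
open import Data.Nat using (ℕ; zero; suc; _+_; _∸_; _≤_; _<_; _⊔_; z≤n; s≤s; s≤s⁻¹; _≤?_)
open import Data.Nat.Properties
open import Data.Bool using (_∧_)
open import Data.Integer as ℤ using (+_; -[1+_]; -≤+)
import Data.Integer.Properties as ℤ
open import Data.Integer.Tactic.RingSolver using (solve-∀)
open import Data.Fin.Subset using (Side; Subset; inside; outside; _∩_; _∪_; _⊆_; _⊈_; ∣_∣; ∁; ⊤; ⊥)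
open import Data.Fin.Subset.Properties
  using (_⊆?_; drop-∷-⊆; out⊆; s⊆s; ⊆-refl; ⊆-reflexive; ⊆-trans; p∩q⊆p; p∩q⊆q; p⊆p∪q;
         x∈p∩q⁺; x∈p∩q⁻; x∈p∪q⁻; ∩-comm; ∩-idem; ∩-identityˡ;
         p⊆q⇒∣p∣≤∣q∣; ∣p∩q∣≤∣p∣; ∣⊥∣≡0; ∣∁p∣≡n∸∣p∣)
open import Data.Vec.Base as Vec using ([]; _∷_; here)
open import Data.Vec.Properties using (∷-injectiveˡ; ∷-injectiveʳ)
open import Data.List.Base using (List; []; _∷_; _++_; length; map)
open import Data.List.Properties using (length-++; length-map)
open import Data.List.Membership.Propositional using (_∈_; find)
open import Data.List.Membership.Propositional.Properties using (∈-map⁺; ∈-map⁻; ∈-∃++; ∈-++⁻; ∈-++⁺ˡ; ∈-++⁺ʳ)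
open import Data.List.Relation.Unary.Any using (here; there)
open import Data.List.Relation.Unary.All as All using (All; []; _∷_; all?)
import Data.List.Relation.Unary.All.Properties as All
open import Data.List.Relation.Unary.AllPairs using ([]; _∷_)
open import Data.List.Relation.Unary.Unique.Propositional using (Unique)
import Data.List.Relation.Unary.Unique.Propositional.Properties as Unique
open import Data.Product using (Σ; ∃; _×_; _,_; proj₁; proj₂)
open import Data.Sum using (_⊎_; inj₁; inj₂; [_,_])
open import Data.Empty using (⊥-elim)
open import Relation.Nullary using (yes; no)
open import Relation.Nullary.Negation using (contradiction)
open import Relation.Binary.PropositionalEquality
  using (_≡_; _≢_; refl; sym; trans; cong; cong₂; subst; subst₂; module ≡-Reasoning)

private variable
  n s : ℕ

Unique⇒length≤ : {A : Set} {xs ys : List A} → Unique xs → (∀ {x} → x ∈ xs → x ∈ ys) → length xs ≤ length ys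
Unique⇒length≤ {xs = []} _ _ = z≤n
Unique⇒length≤ {xs = x ∷ xs} (x∉xs ∷ unique) xs⊆ys with as , bs , refl ← ∈-∃++ (xs⊆ys (here refl)) = begin
  suc (length xs)             ≤⟨ s≤s (Unique⇒length≤ unique xs⊆as++bs) ⟩
  suc (length (as ++ bs))     ≡⟨ cong suc (length-++ as) ⟩
  suc (length as + length bs) ≡⟨ +-suc (length as) (length bs) ⟨
  length as + length (x ∷ bs) ≡⟨ length-++ as ⟨
  length (as ++ x ∷ bs)       ∎
  where
  open ≤-Reasoning
  xs⊆as++bs : ∀ {y} → y ∈ xs → y ∈ as ++ bs
  xs⊆as++bs y∈xs with ∈-++⁻ as (xs⊆ys (there y∈xs))
  ... | inj₁ y∈as         = ∈-++⁺ˡ y∈as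
  ... | inj₂ (here refl)  = contradiction refl (All.lookup x∉xs y∈xs)
  ... | inj₂ (there y∈bs) = ∈-++⁺ʳ as y∈bs

Unique-map⁺-injectiveOn : {A B : Set} {f : A → B} {xs : List A} →
  (∀ {x y} → x ∈ xs → y ∈ xs → f x ≡ f y → x ≡ y) → Unique xs → Unique (map f xs)
Unique-map⁺-injectiveOn {xs = []}     _   []               = []
Unique-map⁺-injectiveOn {xs = x ∷ xs} inj (x∉xs ∷ unique) =
  All.map⁺ (All.tabulate λ y∈ fx≡fy → All.lookup x∉xs y∈ (inj (here refl) (there y∈) fx≡fy)) ∷
  Unique-map⁺-injectiveOn (λ x∈ y∈ → inj (there x∈) (there y∈)) unique

⊆∧∣∣≤⇒≡ : {p q : Subset n} → p ⊆ q → ∣ q ∣ ≤ ∣ p ∣ → p ≡ q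
⊆∧∣∣≤⇒≡ {p = []}          {[]}          _   _ = refl
⊆∧∣∣≤⇒≡ {p = outside ∷ p} {outside ∷ q} p⊆q h = cong (outside ∷_) (⊆∧∣∣≤⇒≡ (drop-∷-⊆ p⊆q) h)
⊆∧∣∣≤⇒≡ {p = outside ∷ p} {inside  ∷ q} p⊆q h = contradiction (p⊆q⇒∣p∣≤∣q∣ (drop-∷-⊆ p⊆q)) (<⇒≱ h)
⊆∧∣∣≤⇒≡ {p = inside  ∷ p} {outside ∷ q} p⊆q h = contradiction (p⊆q here) λ ()
⊆∧∣∣≤⇒≡ {p = inside  ∷ p} {inside  ∷ q} p⊆q h = cong (inside ∷_) (⊆∧∣∣≤⇒≡ (drop-∷-⊆ p⊆q) (s≤s⁻¹ h))

∣p∣≤∣p∩q∣⇒p⊆q : (p q : Subset n) → ∣ p ∣ ≤ ∣ p ∩ q ∣ → p ⊆ q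
∣p∣≤∣p∩q∣⇒p⊆q p q h = subst (_⊆ q) (⊆∧∣∣≤⇒≡ (p∩q⊆p p q) h) (p∩q⊆q p q)

∣r∩p∣+∣r∩q∣≡∣r∩[p∪q]∣+∣r∩p∩q∣ : (r p q : Subset n) →
  ∣ r ∩ p ∣ + ∣ r ∩ q ∣ ≡ ∣ r ∩ (p ∪ q) ∣ + ∣ r ∩ p ∩ q ∣
∣r∩p∣+∣r∩q∣≡∣r∩[p∪q]∣+∣r∩p∩q∣ []            []            []            = refl
∣r∩p∣+∣r∩q∣≡∣r∩[p∪q]∣+∣r∩p∩q∣ (outside ∷ r) (_       ∷ p) (_       ∷ q) = ∣r∩p∣+∣r∩q∣≡∣r∩[p∪q]∣+∣r∩p∩q∣ r p q
∣r∩p∣+∣r∩q∣≡∣r∩[p∪q]∣+∣r∩p∩q∣ (inside  ∷ r) (outside ∷ p) (outside ∷ q) = ∣r∩p∣+∣r∩q∣≡∣r∩[p∪q]∣+∣r∩p∩q∣ r p q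
∣r∩p∣+∣r∩q∣≡∣r∩[p∪q]∣+∣r∩p∩q∣ (inside  ∷ r) (outside ∷ p) (inside  ∷ q) =
  trans (+-suc _ _) (cong suc (∣r∩p∣+∣r∩q∣≡∣r∩[p∪q]∣+∣r∩p∩q∣ r p q))
∣r∩p∣+∣r∩q∣≡∣r∩[p∪q]∣+∣r∩p∩q∣ (inside  ∷ r) (inside  ∷ p) (outside ∷ q) =
  cong suc (∣r∩p∣+∣r∩q∣≡∣r∩[p∪q]∣+∣r∩p∩q∣ r p q)
∣r∩p∣+∣r∩q∣≡∣r∩[p∪q]∣+∣r∩p∩q∣ (inside  ∷ r) (inside  ∷ p) (inside  ∷ q) =
  cong suc (trans (+-suc _ _) (trans (cong suc (∣r∩p∣+∣r∩q∣≡∣r∩[p∪q]∣+∣r∩p∩q∣ r p q)) (sym (+-suc _ _))))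

∣p∣+∣q∣≡∣p∪q∣+∣p∩q∣ : (p q : Subset n) → ∣ p ∣ + ∣ q ∣ ≡ ∣ p ∪ q ∣ + ∣ p ∩ q ∣
∣p∣+∣q∣≡∣p∪q∣+∣p∩q∣ p q = subst₂ _≡_
  (cong₂ _+_ (∣⊤∩∣ p) (∣⊤∩∣ q)) (cong₂ _+_ (∣⊤∩∣ (p ∪ q)) (∣⊤∩∣ (p ∩ q)))
  (∣r∩p∣+∣r∩q∣≡∣r∩[p∪q]∣+∣r∩p∩q∣ ⊤ p q)
  where
  ∣⊤∩∣ : ∀ r → ∣ ⊤ ∩ r ∣ ≡ ∣ r ∣
  ∣⊤∩∣ r = cong ∣_∣ (∩-identityˡ r)

∃-subset-of-size : ∀ {m} → m ≤ n → ∃ λ (p : Subset n) → ∣ p ∣ ≡ m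
∃-subset-of-size {n} {zero} _ = ⊥ , ∣⊥∣≡0 n
∃-subset-of-size {suc n} {suc m} (s≤s m≤n) with p , ∣p∣≡m ← ∃-subset-of-size m≤n = inside ∷ p , cong suc ∣p∣≡m

upperCovers : Subset n → List (Subset n)
upperCovers []            = []
upperCovers (inside  ∷ p) = map (inside ∷_) (upperCovers p)
upperCovers (outside ∷ p) = (inside ∷ p) ∷ map (outside ∷_) (upperCovers p)

lowerCovers : Subset n → List (Subset n)
lowerCovers []            = []
lowerCovers (outside ∷ p) = map (outside ∷_) (lowerCovers p)
lowerCovers (inside  ∷ p) = (outside ∷ p) ∷ map (inside ∷_) (lowerCovers p)

length-upperCovers : (p : Subset n) → length (upperCovers p) ≡ ∣ ∁ p ∣
length-upperCovers []            = refl
length-upperCovers (inside  ∷ p) = trans (length-map _ (upperCovers p)) (length-upperCovers p)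
length-upperCovers (outside ∷ p) = cong suc (trans (length-map _ (upperCovers p)) (length-upperCovers p))

length-lowerCovers : (p : Subset n) → length (lowerCovers p) ≡ ∣ p ∣
length-lowerCovers []            = refl
length-lowerCovers (outside ∷ p) = trans (length-map _ (lowerCovers p)) (length-lowerCovers p)
length-lowerCovers (inside  ∷ p) = cong suc (trans (length-map _ (lowerCovers p)) (length-lowerCovers p))

upperCovers-unique : (p : Subset n) → Unique (upperCovers p)
upperCovers-unique []            = []
upperCovers-unique (inside  ∷ p) = Unique.map⁺ ∷-injectiveʳ (upperCovers-unique p)
upperCovers-unique (outside ∷ p) =
  All.map⁺ (All.tabulate λ _ ()) ∷ Unique.map⁺ ∷-injectiveʳ (upperCovers-unique p)

lowerCovers-unique : (p : Subset n) → Unique (lowerCovers p)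
lowerCovers-unique []            = []
lowerCovers-unique (outside ∷ p) = Unique.map⁺ ∷-injectiveʳ (lowerCovers-unique p)
lowerCovers-unique (inside  ∷ p) =
  All.map⁺ (All.tabulate λ _ ()) ∷ Unique.map⁺ ∷-injectiveʳ (lowerCovers-unique p)

∈-upperCovers⁺ : {p q : Subset n} → p ⊆ q → ∣ q ∣ ≡ suc ∣ p ∣ → q ∈ upperCovers p
∈-upperCovers⁺ {p = []}          {[]}          _   ()
∈-upperCovers⁺ {p = inside  ∷ p} {inside  ∷ q} p⊆q e =
  ∈-map⁺ _ (∈-upperCovers⁺ (drop-∷-⊆ p⊆q) (suc-injective e))
∈-upperCovers⁺ {p = inside  ∷ p} {outside ∷ q} p⊆q _ = contradiction (p⊆q here) λ ()
∈-upperCovers⁺ {p = outside ∷ p} {inside  ∷ q} p⊆q e =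
  here (cong (inside ∷_) (sym (⊆∧∣∣≤⇒≡ (drop-∷-⊆ p⊆q) (≤-reflexive (suc-injective e)))))
∈-upperCovers⁺ {p = outside ∷ p} {outside ∷ q} p⊆q e = there (∈-map⁺ _ (∈-upperCovers⁺ (drop-∷-⊆ p⊆q) e))

∈-lowerCovers⁺ : {p q : Subset n} → q ⊆ p → suc ∣ q ∣ ≡ ∣ p ∣ → q ∈ lowerCovers p
∈-lowerCovers⁺ {p = []}          {[]}          _   ()
∈-lowerCovers⁺ {p = outside ∷ p} {outside ∷ q} q⊆p e = ∈-map⁺ _ (∈-lowerCovers⁺ (drop-∷-⊆ q⊆p) e)
∈-lowerCovers⁺ {p = outside ∷ p} {inside  ∷ q} q⊆p _ = contradiction (q⊆p here) λ ()
∈-lowerCovers⁺ {p = inside  ∷ p} {outside ∷ q} q⊆p e =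
  here (cong (outside ∷_) (⊆∧∣∣≤⇒≡ (drop-∷-⊆ q⊆p) (≤-reflexive (sym (suc-injective e)))))
∈-lowerCovers⁺ {p = inside  ∷ p} {inside  ∷ q} q⊆p e =
  there (∈-map⁺ _ (∈-lowerCovers⁺ (drop-∷-⊆ q⊆p) (suc-injective e)))

∈-upperCovers⁻ : (p : Subset n) {q : Subset n} → q ∈ upperCovers p → p ⊆ q × ∣ q ∣ ≡ suc ∣ p ∣
∈-upperCovers⁻ (inside ∷ p) q∈ with q , q∈′ , refl ← ∈-map⁻ _ q∈ with p⊆q , e ← ∈-upperCovers⁻ p q∈′ =
  s⊆s p⊆q , cong suc e
∈-upperCovers⁻ (outside ∷ p) (here refl) = out⊆ ⊆-refl , refl
∈-upperCovers⁻ (outside ∷ p) (there q∈)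
  with q , q∈′ , refl ← ∈-map⁻ _ q∈ with p⊆q , e ← ∈-upperCovers⁻ p q∈′ =
  s⊆s p⊆q , e

∈-lowerCovers⁻ : (p : Subset n) {q : Subset n} → q ∈ lowerCovers p → q ⊆ p × suc ∣ q ∣ ≡ ∣ p ∣
∈-lowerCovers⁻ (outside ∷ p) q∈ with q , q∈′ , refl ← ∈-map⁻ _ q∈ with q⊆p , e ← ∈-lowerCovers⁻ p q∈′ =
  s⊆s q⊆p , e
∈-lowerCovers⁻ (inside ∷ p) (here refl) = out⊆ ⊆-refl , refl
∈-lowerCovers⁻ (inside ∷ p) (there q∈)
  with q , q∈′ , refl ← ∈-map⁻ _ q∈ with q⊆p , e ← ∈-lowerCovers⁻ p q∈′ =
  s⊆s q⊆p , cong suc e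

SetAdmissible : (n k l : ℕ) → List (Subset n) → Set
SetAdmissible n k l 𝒢 =
  Unique 𝒢 ×
  All (λ p → ∣ p ∣ ≡ k) 𝒢 ×
  All (λ p → All (λ q → l ≤ ∣ p ∩ q ∣) 𝒢) 𝒢

upperCovers-setAdmissible : (p : Subset n) → SetAdmissible n (suc ∣ p ∣) ∣ p ∣ (upperCovers p)
upperCovers-setAdmissible p =
  upperCovers-unique p ,
  All.tabulate (λ q∈ → proj₂ (∈-upperCovers⁻ p q∈)) ,
  All.tabulate λ q∈ → All.tabulate λ q′∈ → core≤ (proj₁ (∈-upperCovers⁻ p q∈)) (proj₁ (∈-upperCovers⁻ p q′∈))
  where
  core≤ : ∀ {q q′} → p ⊆ q → p ⊆ q′ → ∣ p ∣ ≤ ∣ q ∩ q′ ∣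
  core≤ p⊆q p⊆q′ = p⊆q⇒∣p∣≤∣q∣ λ x∈p → x∈p∩q⁺ (p⊆q x∈p , p⊆q′ x∈p)

lowerCovers-setAdmissible : (p : Subset n) → ∣ p ∣ ≡ suc (suc s) → SetAdmissible n (suc s) s (lowerCovers p)
lowerCovers-setAdmissible {s = s} p ∣p∣≡ =
  lowerCovers-unique p ,
  All.tabulate (λ q∈ → size q∈) ,
  All.tabulate λ q∈ → All.tabulate λ q′∈ → hull≤ q∈ q′∈
  where
  size : ∀ {q} → q ∈ lowerCovers p → ∣ q ∣ ≡ suc s
  size q∈ = suc-injective (trans (proj₂ (∈-lowerCovers⁻ p q∈)) ∣p∣≡)
  hull≤ : ∀ {q q′} → q ∈ lowerCovers p → q′ ∈ lowerCovers p → s ≤ ∣ q ∩ q′ ∣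
  hull≤ {q} {q′} q∈ q′∈ = +-cancelˡ-≤ (suc (suc s)) s ∣ q ∩ q′ ∣ (begin
    suc (suc s) + s         ≡⟨ cong suc (+-suc s s) ⟨
    suc s + suc s           ≡⟨ cong₂ _+_ (size q∈) (size q′∈) ⟨
    ∣ q ∣ + ∣ q′ ∣          ≡⟨ ∣p∣+∣q∣≡∣p∪q∣+∣p∩q∣ q q′ ⟩
    ∣ q ∪ q′ ∣ + ∣ q ∩ q′ ∣ ≤⟨ +-monoˡ-≤ ∣ q ∩ q′ ∣ (p⊆q⇒∣p∣≤∣q∣ q∪q′⊆p) ⟩
    ∣ p ∣ + ∣ q ∩ q′ ∣      ≡⟨ cong (_+ ∣ q ∩ q′ ∣) ∣p∣≡ ⟩
    suc (suc s) + ∣ q ∩ q′ ∣ ∎)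
    where
    open ≤-Reasoning
    q∪q′⊆p : q ∪ q′ ⊆ p
    q∪q′⊆p x∈ = [ proj₁ (∈-lowerCovers⁻ p q∈) , proj₁ (∈-lowerCovers⁻ p q′∈) ] (x∈p∪q⁻ q q′ x∈)

∣p∩q∣≡s : {p q : Subset n} → ∣ p ∣ ≡ suc s → ∣ q ∣ ≡ suc s → s ≤ ∣ p ∩ q ∣ → p ≢ q → ∣ p ∩ q ∣ ≡ s
∣p∩q∣≡s {s = s} {p} {q} ∣p∣≡ ∣q∣≡ s≤∣p∩q∣ p≢q =
  ≤-antisym (s≤s⁻¹ (≤∧≢⇒< (subst (∣ p ∩ q ∣ ≤_) ∣p∣≡ (∣p∩q∣≤∣p∣ p q)) ∣p∩q∣≢1+s)) s≤∣p∩q∣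
  where
  ∣p∩q∣≢1+s : ∣ p ∩ q ∣ ≢ suc s
  ∣p∩q∣≢1+s e = p≢q (⊆∧∣∣≤⇒≡ (∣p∣≤∣p∩q∣⇒p⊆q p q (≤-reflexive (trans ∣p∣≡ (sym e))))
                             (≤-reflexive (trans ∣q∣≡ (sym ∣p∣≡))))

∣p∪q∣≡2+s : {p q : Subset n} → ∣ p ∣ ≡ suc s → ∣ q ∣ ≡ suc s → ∣ p ∩ q ∣ ≡ s → ∣ p ∪ q ∣ ≡ suc (suc s)
∣p∪q∣≡2+s {s = s} {p} {q} ∣p∣≡ ∣q∣≡ ∣p∩q∣≡ = +-cancelʳ-≡ s _ _ (begin
  ∣ p ∪ q ∣ + s         ≡⟨ cong (λ t → ∣ p ∪ q ∣ + t) ∣p∩q∣≡ ⟨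
  ∣ p ∪ q ∣ + ∣ p ∩ q ∣ ≡⟨ ∣p∣+∣q∣≡∣p∪q∣+∣p∩q∣ p q ⟨
  ∣ p ∣ + ∣ q ∣         ≡⟨ cong₂ _+_ ∣p∣≡ ∣q∣≡ ⟩
  suc s + suc s         ≡⟨ cong suc (+-suc s s) ⟩
  suc (suc s) + s       ∎)
  where open ≡-Reasoning

⊇core⊎⊆hull : (p q r : Subset n) → ∣ p ∩ q ∣ ≡ s → ∣ r ∣ ≡ suc s → s ≤ ∣ r ∩ p ∣ → s ≤ ∣ r ∩ q ∣ →
  p ∩ q ⊆ r ⊎ r ⊆ p ∪ q
⊇core⊎⊆hull {s = s} p q r ∣p∩q∣≡ ∣r∣≡ s≤∣r∩p∣ s≤∣r∩q∣ with suc s ≤? ∣ r ∩ (p ∪ q) ∣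
... | yes s<∣r∩[p∪q]∣ = inj₂ (∣p∣≤∣p∩q∣⇒p⊆q r (p ∪ q) (subst (_≤ ∣ r ∩ (p ∪ q) ∣) (sym ∣r∣≡) s<∣r∩[p∪q]∣))
... | no  s≮∣r∩[p∪q]∣ = inj₁ (∣p∣≤∣p∩q∣⇒p⊆q (p ∩ q) r
        (subst₂ _≤_ (sym ∣p∩q∣≡) (cong ∣_∣ (∩-comm r (p ∩ q))) s≤∣r∩p∩q∣))
  where
  open ≤-Reasoning
  s≤∣r∩p∩q∣ : s ≤ ∣ r ∩ p ∩ q ∣
  s≤∣r∩p∩q∣ = +-cancelˡ-≤ s s _ (begin
    s + s                           ≤⟨ +-mono-≤ s≤∣r∩p∣ s≤∣r∩q∣ ⟩
    ∣ r ∩ p ∣ + ∣ r ∩ q ∣           ≡⟨ ∣r∩p∣+∣r∩q∣≡∣r∩[p∪q]∣+∣r∩p∩q∣ r p q ⟩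
    ∣ r ∩ (p ∪ q) ∣ + ∣ r ∩ p ∩ q ∣ ≤⟨ +-monoˡ-≤ _ (s≤s⁻¹ (≰⇒> s≮∣r∩[p∪q]∣)) ⟩
    s + ∣ r ∩ p ∩ q ∣               ∎)

⊇core⇒⊆hull : {S U r₁ r₂ : Subset n} → S ⊆ U → ∣ S ∣ ≡ s → r₁ ⊆ U → S ⊈ r₁ →
  S ⊆ r₂ → ∣ r₂ ∣ ≡ suc s → s ≤ ∣ r₁ ∩ r₂ ∣ → r₂ ⊆ U
⊇core⇒⊆hull {s = s} {S} {U} {r₁} {r₂} S⊆U ∣S∣≡ r₁⊆U S⊈r₁ S⊆r₂ ∣r₂∣≡ s≤∣r₁∩r₂∣ with suc s ≤? ∣ r₂ ∩ U ∣
... | yes s<∣r₂∩U∣ = ∣p∣≤∣p∩q∣⇒p⊆q r₂ U (subst (_≤ ∣ r₂ ∩ U ∣) (sym ∣r₂∣≡) s<∣r₂∩U∣)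
... | no  s≮∣r₂∩U∣ = ⊥-elim (S⊈r₁ S⊆r₁)
  where
  open ≤-Reasoning
  r₂∩U≡S : r₂ ∩ U ≡ S
  r₂∩U≡S = sym (⊆∧∣∣≤⇒≡ (λ x∈S → x∈p∩q⁺ (S⊆r₂ x∈S , S⊆U x∈S))
                        (subst (∣ r₂ ∩ U ∣ ≤_) (sym ∣S∣≡) (s≤s⁻¹ (≰⇒> s≮∣r₂∩U∣))))
  r₁∩r₂⊆S∩r₁ : r₁ ∩ r₂ ⊆ S ∩ r₁
  r₁∩r₂⊆S∩r₁ x∈ with x∈r₁ , x∈r₂ ← x∈p∩q⁻ r₁ r₂ x∈ =
    x∈p∩q⁺ (⊆-reflexive r₂∩U≡S (x∈p∩q⁺ (x∈r₂ , r₁⊆U x∈r₁)) , x∈r₁)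
  S⊆r₁ : S ⊆ r₁
  S⊆r₁ = ∣p∣≤∣p∩q∣⇒p⊆q S r₁ (begin
    ∣ S ∣       ≡⟨ ∣S∣≡ ⟩
    s           ≤⟨ s≤∣r₁∩r₂∣ ⟩
    ∣ r₁ ∩ r₂ ∣ ≤⟨ p⊆q⇒∣p∣≤∣q∣ r₁∩r₂⊆S∩r₁ ⟩
    ∣ S ∩ r₁ ∣  ∎)

core-or-hull : {𝒢 : List (Subset n)} {p q : Subset n} →
  All (λ r → ∣ r ∣ ≡ suc s) 𝒢 → All (λ r → All (λ r′ → s ≤ ∣ r ∩ r′ ∣) 𝒢) 𝒢 →
  p ∈ 𝒢 → q ∈ 𝒢 → ∣ p ∩ q ∣ ≡ s →
  All (p ∩ q ⊆_) 𝒢 ⊎ All (_⊆ p ∪ q) 𝒢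
core-or-hull {s = s} {𝒢 = 𝒢} {p} {q} sizes meets p∈ q∈ ∣p∩q∣≡ with all? (p ∩ q ⊆?_) 𝒢
... | yes all⊇core = inj₁ all⊇core
... | no ¬all⊇core with r₁ , r₁∈ , core⊈r₁ ← find (All.¬All⇒Any¬ (p ∩ q ⊆?_) 𝒢 ¬all⊇core) =
  inj₂ (All.tabulate ⊆hull)
  where
  meet : ∀ {r r′} → r ∈ 𝒢 → r′ ∈ 𝒢 → s ≤ ∣ r ∩ r′ ∣
  meet r∈ r′∈ = All.lookup (All.lookup meets r∈) r′∈
  ⊆hull-of-⊈core : ∀ {r} → r ∈ 𝒢 → p ∩ q ⊈ r → r ⊆ p ∪ q
  ⊆hull-of-⊈core {r} r∈ core⊈r with ⊇core⊎⊆hull p q r ∣p∩q∣≡ (All.lookup sizes r∈) (meet r∈ p∈) (meet r∈ q∈)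
  ... | inj₁ core⊆r  = ⊥-elim (core⊈r core⊆r)
  ... | inj₂ r⊆hull = r⊆hull
  ⊆hull : ∀ {r} → r ∈ 𝒢 → r ⊆ p ∪ q
  ⊆hull {r} r∈ with p ∩ q ⊆? r
  ... | no  core⊈r = ⊆hull-of-⊈core r∈ core⊈r
  ... | yes core⊆r = ⊇core⇒⊆hull (⊆-trans (p∩q⊆p p q) (p⊆p∪q q)) ∣p∩q∣≡ (⊆hull-of-⊈core r₁∈ core⊈r₁)
                       core⊈r₁ core⊆r (All.lookup sizes r∈) (meet r₁∈ r∈)

setAdmissible-length≤ : {𝒢 : List (Subset n)} → SetAdmissible n (suc s) s 𝒢 → length 𝒢 ≤ suc (suc s) ⊔ (n ∸ s)
setAdmissible-length≤ {𝒢 = []} _ = z≤n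
setAdmissible-length≤ {n} {s} {𝒢 = _ ∷ []} _ = ≤-trans (s≤s z≤n) (m≤m⊔n (suc (suc s)) (n ∸ s))
setAdmissible-length≤ {n} {s} {𝒢 = 𝒢@(p ∷ q ∷ _)} (unique@((p≢q ∷ _) ∷ _) , sizes , meets) =
  [ viaCore , viaHull ] (core-or-hull sizes meets p∈ q∈ ∣p∩q∣≡)
  where
  open ≤-Reasoning
  p∈ : p ∈ 𝒢
  p∈ = here refl
  q∈ : q ∈ 𝒢
  q∈ = there (here refl)
  ∣p∩q∣≡ : ∣ p ∩ q ∣ ≡ s
  ∣p∩q∣≡ = ∣p∩q∣≡s (All.lookup sizes p∈) (All.lookup sizes q∈) (All.lookup (All.lookup meets p∈) q∈) p≢q
  viaCore : All (p ∩ q ⊆_) 𝒢 → length 𝒢 ≤ suc (suc s) ⊔ (n ∸ s)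
  viaCore all⊇core = begin
    length 𝒢                     ≤⟨ Unique⇒length≤ unique (λ r∈ → ∈-upperCovers⁺ (All.lookup all⊇core r∈)
                                      (trans (All.lookup sizes r∈) (cong suc (sym ∣p∩q∣≡)))) ⟩
    length (upperCovers (p ∩ q)) ≡⟨ length-upperCovers (p ∩ q) ⟩
    ∣ ∁ (p ∩ q) ∣                ≡⟨ ∣∁p∣≡n∸∣p∣ (p ∩ q) ⟩
    n ∸ ∣ p ∩ q ∣                ≡⟨ cong (n ∸_) ∣p∩q∣≡ ⟩
    n ∸ s                        ≤⟨ m≤n⊔m (suc (suc s)) (n ∸ s) ⟩
    suc (suc s) ⊔ (n ∸ s)        ∎
  viaHull : All (_⊆ p ∪ q) 𝒢 → length 𝒢 ≤ suc (suc s) ⊔ (n ∸ s)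
  viaHull all⊆hull = begin
    length 𝒢                     ≤⟨ Unique⇒length≤ unique (λ r∈ → ∈-lowerCovers⁺ (All.lookup all⊆hull r∈)
                                      (trans (cong suc (All.lookup sizes r∈)) (sym ∣p∪q∣≡))) ⟩
    length (lowerCovers (p ∪ q)) ≡⟨ length-lowerCovers (p ∪ q) ⟩
    ∣ p ∪ q ∣                    ≡⟨ ∣p∪q∣≡ ⟩
    suc (suc s)                  ≤⟨ m≤m⊔n (suc (suc s)) (n ∸ s) ⟩
    suc (suc s) ⊔ (n ∸ s)        ∎
    where
    ∣p∪q∣≡ : ∣ p ∪ q ∣ ≡ suc (suc s)
    ∣p∪q∣≡ = ∣p∪q∣≡2+s {p = p} {q} (All.lookup sizes p∈) (All.lookup sizes q∈) ∣p∩q∣≡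

isNonzero : Sgn → Side
isNonzero zer = outside
isNonzero _   = inside

support : SVec n → Subset n
support = Vec.map isNonzero

indicator : Subset n → SVec n
indicator []            = []
indicator (inside  ∷ p) = pos ∷ indicator p
indicator (outside ∷ p) = zer ∷ indicator p

∣support∣≡weight : (v : SVec n) → ∣ support v ∣ ≡ weight v
∣support∣≡weight []        = refl
∣support∣≡weight (neg ∷ v) = cong suc (∣support∣≡weight v)
∣support∣≡weight (zer ∷ v) = ∣support∣≡weight v
∣support∣≡weight (pos ∷ v) = cong suc (∣support∣≡weight v)

support-indicator : (p : Subset n) → support (indicator p) ≡ p
support-indicator []            = refl
support-indicator (inside  ∷ p) = cong (inside ∷_) (support-indicator p)
support-indicator (outside ∷ p) = cong (outside ∷_) (support-indicator p)

inner-indicator : (p q : Subset n) → inner (indicator p) (indicator q) ≡ + ∣ p ∩ q ∣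
inner-indicator []            []            = refl
inner-indicator (inside  ∷ p) (inside  ∷ q) = cong (ℤ._+_ (+ 1)) (inner-indicator p q)
inner-indicator (inside  ∷ p) (outside ∷ q) = trans (ℤ.+-identityˡ _) (inner-indicator p q)
inner-indicator (outside ∷ p) (inside  ∷ q) = trans (ℤ.+-identityˡ _) (inner-indicator p q)
inner-indicator (outside ∷ p) (outside ∷ q) = trans (ℤ.+-identityˡ _) (inner-indicator p q)

inner≤∣support∩support∣ : (v w : SVec n) → inner v w ℤ.≤ + ∣ support v ∩ support w ∣
inner≤∣support∩support∣ []      []      = ℤ.≤-refl
inner≤∣support∩support∣ (a ∷ v) (b ∷ w) = step a b {r = support v ∩ support w} (inner≤∣support∩support∣ v w)
  where
  step : ∀ a b {i} {r : Subset _} → i ℤ.≤ + ∣ r ∣ →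
    toℤ a ℤ.* toℤ b ℤ.+ i ℤ.≤ + ∣ (isNonzero a ∧ isNonzero b) ∷ r ∣
  step neg neg h = ℤ.+-monoʳ-≤ (+ 1) h
  step neg zer h = ℤ.+-monoʳ-≤ (+ 0) h
  step neg pos {r = r} h = ℤ.≤-trans (ℤ.+-monoʳ-≤ -[1+ 0 ] h) (ℤ.+-monoˡ-≤ (+ ∣ r ∣) (-≤+ {0} {1}))
  step zer neg h = ℤ.+-monoʳ-≤ (+ 0) h
  step zer zer h = ℤ.+-monoʳ-≤ (+ 0) h
  step zer pos h = ℤ.+-monoʳ-≤ (+ 0) h
  step pos neg {r = r} h = ℤ.≤-trans (ℤ.+-monoʳ-≤ -[1+ 0 ] h) (ℤ.+-monoˡ-≤ (+ ∣ r ∣) (-≤+ {0} {1}))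
  step pos zer h = ℤ.+-monoʳ-≤ (+ 0) h
  step pos pos h = ℤ.+-monoʳ-≤ (+ 1) h

inner≤weight : (v w : SVec n) → support v ≡ support w → inner v w ℤ.≤ + weight v
inner≤weight v w e = subst (λ m → inner v w ℤ.≤ + m) ∣support∩support∣≡weight (inner≤∣support∩support∣ v w)
  where
  ∣support∩support∣≡weight : ∣ support v ∩ support w ∣ ≡ weight v
  ∣support∩support∣≡weight = trans (cong (λ p → ∣ support v ∩ p ∣) (sym e))
                               (trans (cong ∣_∣ (∩-idem (support v))) (∣support∣≡weight v))

support-≡⇒≡⊎inner+2≤weight : (v w : SVec n) → support v ≡ support w →
  v ≡ w ⊎ inner v w ℤ.+ + 2 ℤ.≤ + weight v
support-≡⇒≡⊎inner+2≤weight []      []      _ = inj₁ refl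
support-≡⇒≡⊎inner+2≤weight (a ∷ v) (b ∷ w) e =
  step a b (∷-injectiveˡ e) (support-≡⇒≡⊎inner+2≤weight v w (∷-injectiveʳ e))
    (inner≤weight v w (∷-injectiveʳ e))
  where
  agree : ∀ c → toℤ c ℤ.* toℤ c ≡ + nz c → v ≡ w ⊎ inner v w ℤ.+ + 2 ℤ.≤ + weight v →
    c ∷ v ≡ c ∷ w ⊎ inner (c ∷ v) (c ∷ w) ℤ.+ + 2 ℤ.≤ + weight (c ∷ v)
  agree _ _   (inj₁ v≡w) = inj₁ (cong (_ ∷_) v≡w)
  agree c c²≡ (inj₂ h)   = inj₂ (ℤ.≤-trans
    (ℤ.≤-reflexive (trans (ℤ.+-assoc (toℤ c ℤ.* toℤ c) (inner v w) (+ 2))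
                          (cong (ℤ._+ (inner v w ℤ.+ + 2)) c²≡)))
    (ℤ.+-monoʳ-≤ (+ nz c) h))
  -1+i+2≡1+i : ∀ i → -[1+ 0 ] ℤ.+ i ℤ.+ + 2 ≡ + 1 ℤ.+ i
  -1+i+2≡1+i = solve-∀
  oppose : inner v w ℤ.≤ + weight v → -[1+ 0 ] ℤ.+ inner v w ℤ.+ + 2 ℤ.≤ + suc (weight v)
  oppose h = ℤ.≤-trans (ℤ.≤-reflexive (-1+i+2≡1+i (inner v w))) (ℤ.+-monoʳ-≤ (+ 1) h)
  step : ∀ a b → isNonzero a ≡ isNonzero b →
    v ≡ w ⊎ inner v w ℤ.+ + 2 ℤ.≤ + weight v → inner v w ℤ.≤ + weight v →
    a ∷ v ≡ b ∷ w ⊎ inner (a ∷ v) (b ∷ w) ℤ.+ + 2 ℤ.≤ + weight (a ∷ v)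
  step neg neg _  tail _ = agree neg refl tail
  step zer zer _  tail _ = agree zer refl tail
  step pos pos _  tail _ = agree pos refl tail
  step neg pos _  _    h = inj₂ (oppose h)
  step pos neg _  _    h = inj₂ (oppose h)
  step neg zer () _    _
  step zer neg () _    _
  step zer pos () _    _
  step pos zer () _    _

admissible⇒supports-setAdmissible : {𝒱 : List (SVec n)} → Admissible n (suc s) (+ s) 𝒱 →
  SetAdmissible n (suc s) s (map support 𝒱)
admissible⇒supports-setAdmissible {n} {s} {𝒱} (unique , weights , products) =
  Unique-map⁺-injectiveOn support-injectiveOn unique ,
  All.map⁺ (All.map (λ {v} → trans (∣support∣≡weight v)) weights) ,
  All.map⁺ (All.map (λ {v} products-v → All.map⁺ (All.map (λ {w} s≤vw →
    ℤ.drop‿+≤+ (ℤ.≤-trans s≤vw (inner≤∣support∩support∣ v w))) products-v)) products)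
  where
  support-injectiveOn : ∀ {v w} → v ∈ 𝒱 → w ∈ 𝒱 → support v ≡ support w → v ≡ w
  support-injectiveOn {v} {w} v∈ w∈ e with support-≡⇒≡⊎inner+2≤weight v w e
  ... | inj₁ v≡w = v≡w
  ... | inj₂ h   = contradiction (≤-trans (≤-reflexive (+-comm 2 s)) s+2≤1+s) (<-irrefl refl)
    where
    s+2≤1+s : s + 2 ≤ suc s
    s+2≤1+s = ℤ.drop‿+≤+ (ℤ.≤-trans (ℤ.+-monoˡ-≤ (+ 2) (All.lookup (All.lookup products v∈) w∈))
                 (subst (λ m → inner v w ℤ.+ + 2 ℤ.≤ + m) (All.lookup weights v∈) h))

setAdmissible⇒indicators-admissible : ∀ {k l} {𝒢 : List (Subset n)} → SetAdmissible n k l 𝒢 →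
  Admissible n k (+ l) (map indicator 𝒢)
setAdmissible⇒indicators-admissible {l = l} (unique , sizes , meets) =
  Unique.map⁺ indicator-injective unique ,
  All.map⁺ (All.map (λ {p} → trans (weight-indicator p)) sizes) ,
  All.map⁺ (All.map (λ {p} meets-p → All.map⁺ (All.map (λ {q} l≤ →
    subst (+ l ℤ.≤_) (sym (inner-indicator p q)) (ℤ.+≤+ l≤)) meets-p)) meets)
  where
  weight-indicator : ∀ p → weight (indicator p) ≡ ∣ p ∣
  weight-indicator p = trans (sym (∣support∣≡weight (indicator p))) (cong ∣_∣ (support-indicator p))
  indicator-injective : ∀ {p q} → indicator p ≡ indicator q → p ≡ q
  indicator-injective {p} {q} e =
    trans (sym (support-indicator p)) (trans (cong support e) (support-indicator q))

indicators-realise : ∀ {k l m} {𝒢 : List (Subset n)} → SetAdmissible n k l 𝒢 → length 𝒢 ≡ m →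
  Σ (List (SVec n)) λ 𝒱 → Admissible n k (+ l) 𝒱 × length 𝒱 ≡ m
indicators-realise {𝒢 = 𝒢} admissible length≡ =
  map indicator 𝒢 , setAdmissible⇒indicators-admissible admissible , trans (length-map indicator 𝒢) length≡

∃-admissible-of-length : suc s < n →
  Σ (List (SVec n)) λ 𝒱 → Admissible n (suc s) (+ s) 𝒱 × length 𝒱 ≡ suc (suc s) ⊔ (n ∸ s)
∃-admissible-of-length {s} {n} 1+s<n with ≤-total (n ∸ s) (suc (suc s))
... | inj₁ n∸s≤2+s with U , ∣U∣≡ ← ∃-subset-of-size 1+s<n =
  indicators-realise (lowerCovers-setAdmissible U ∣U∣≡) (begin
    length (lowerCovers U) ≡⟨ length-lowerCovers U ⟩
    ∣ U ∣                  ≡⟨ ∣U∣≡ ⟩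
    suc (suc s)            ≡⟨ m≥n⇒m⊔n≡m n∸s≤2+s ⟨
    suc (suc s) ⊔ (n ∸ s)  ∎)
  where open ≡-Reasoning
... | inj₂ 2+s≤n∸s with S , refl ← ∃-subset-of-size (≤-trans (n≤1+n s) (<⇒≤ 1+s<n)) =
  indicators-realise (upperCovers-setAdmissible S) (begin
    length (upperCovers S)      ≡⟨ length-upperCovers S ⟩
    ∣ ∁ S ∣                     ≡⟨ ∣∁p∣≡n∸∣p∣ S ⟩
    n ∸ ∣ S ∣                   ≡⟨ m≤n⇒m⊔n≡n 2+s≤n∸s ⟨
    suc (suc ∣ S ∣) ⊔ (n ∸ ∣ S ∣) ∎)
  where open ≡-Reasoning

admissible-length≤ : {𝒱 : List (SVec n)} → Admissible n (suc s) (+ s) 𝒱 → length 𝒱 ≤ suc (suc s) ⊔ (n ∸ s)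
admissible-length≤ {𝒱 = 𝒱} admissible =
  subst (_≤ _) (length-map support 𝒱) (setAdmissible-length≤ (admissible⇒supports-setAdmissible admissible))

proposition3 : ∀ (n k : ℕ) → 1 ≤ k → k < n →
    IsF n k (+ (k ∸ 1)) (suc k ⊔ suc (n ∸ k))
proposition3 (suc n) (suc s) _ 1+s<1+n =
  subst (IsF (suc n) (suc s) (+ s)) (cong (suc (suc s) ⊔_) (+-∸-assoc 1 s≤n))
    (∃-admissible-of-length 1+s<1+n , λ _ → admissible-length≤)
  where
  s≤n : s ≤ n
  s≤n = <⇒≤ (s≤s⁻¹ 1+s<1+n)
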